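{- Every homomorphism of the signed graph $\widehat{T}$ to $\widehat{K}^s_{10;3}$ is surjective (on vertices).
   Context: $\widehat{T}$ is the signed graph on vertices $v_1,\dots,v_5$ whose positive edges are $v_1v_2,v_2v_3,v_3v_4,v_4v_5,v_5v_1$ and whose negative edges are $v_2v_4$ and $v_3v_5$. $K^s_{10;3}$ is the signed graph on $\{0,\dots,9\}$ in which $ij$ is a negative edge iff $3\le|i-j|\le 7$ and a positive edge iff $|i-j|\le 2$ or $|i-j|\ge 8$ (so each vertex carries a positive loop); $\widehat{K}^s_{10;3}$ is its signed subgraph induced by $\{0,1,2,3,4\}$. Switching a vertex reverses the signs of all edges at it. A homomorphism of a signed graph $(G,\sigma)$ to $(H,\pi)$ is a vertex map $f$ such that, for some signature $\sigma'$ obtained from $\sigma$ by switching, every edge $uv$ maps to an edge $f(u)f(v)$ with $\pi(f(u)f(v))=\sigma'(uv)$. -}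

module Defs where

open import Data.Nat using (ℕ; _≤ᵇ_; _∸_; _+_)
open import Data.Fin using (Fin; toℕ)
open import Data.Bool using (Bool; true; false; _xor_; _∨_; _∧_)
open import Data.Maybe using (Maybe; just; nothing)
open import Data.Product using (Σ; ∃; _,_)
open import Relation.Binary.PropositionalEquality using (_≡_)

-- A sign: true = negative, false = positive (so switching = xor).
Sign : Set
Sign = Bool

-- A signed graph (possibly with loops) on vertex set Fin n:
-- edge u v = nothing  if uv is not an edge,
--            just s   if uv is an edge of sign s.
-- The graphs below are given by symmetric functions (undirected edges).
record SignedGraph (n : ℕ) : Set where
  field
    edge : Fin n → Fin n → Maybe Sign
open SignedGraph public

-- A switching is the set of switched vertices (its characteristic function).
-- The sign of uv after switching the set S is  σ(uv) xor [u∈S] xor [v∈S].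
switchedSign : ∀ {n} → (Fin n → Bool) → Fin n → Fin n → Sign → Sign
switchedSign S u v s = (s xor S u) xor S v

IsHom : ∀ {m n} → SignedGraph m → SignedGraph n → (Fin m → Fin n) → Set
IsHom {m} G H f =
  Σ (Fin m → Bool) λ S →
    ∀ u v s → edge G u v ≡ just s →
      edge H (f u) (f v) ≡ just (switchedSign S u v s)

Surjective : ∀ {m n} → (Fin m → Fin n) → Set
Surjective {m} {n} f = ∀ (y : Fin n) → ∃ λ (x : Fin m) → f x ≡ y

-- Vertices of T̂: index i stands for v_{i+1}.
-- Positive: v1v2, v2v3, v3v4, v4v5, v5v1 ; negative: v2v4, v3v5.
-- (indices: 01,12,23,34,40 positive; 13,24 negative)
tEdge : Fin 5 → Fin 5 → Maybe Sign
tEdge Fin.zero (Fin.suc Fin.zero) = just false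
tEdge (Fin.suc Fin.zero) Fin.zero = just false
tEdge (Fin.suc Fin.zero) (Fin.suc (Fin.suc Fin.zero)) = just false
tEdge (Fin.suc (Fin.suc Fin.zero)) (Fin.suc Fin.zero) = just false
tEdge (Fin.suc (Fin.suc Fin.zero)) (Fin.suc (Fin.suc (Fin.suc Fin.zero))) = just false
tEdge (Fin.suc (Fin.suc (Fin.suc Fin.zero))) (Fin.suc (Fin.suc Fin.zero)) = just false
tEdge (Fin.suc (Fin.suc (Fin.suc Fin.zero))) (Fin.suc (Fin.suc (Fin.suc (Fin.suc Fin.zero)))) = just false
tEdge (Fin.suc (Fin.suc (Fin.suc (Fin.suc Fin.zero)))) (Fin.suc (Fin.suc (Fin.suc Fin.zero))) = just false
tEdge (Fin.suc (Fin.suc (Fin.suc (Fin.suc Fin.zero)))) Fin.zero = just false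
tEdge Fin.zero (Fin.suc (Fin.suc (Fin.suc (Fin.suc Fin.zero)))) = just false
tEdge (Fin.suc Fin.zero) (Fin.suc (Fin.suc (Fin.suc Fin.zero))) = just true
tEdge (Fin.suc (Fin.suc (Fin.suc Fin.zero))) (Fin.suc Fin.zero) = just true
tEdge (Fin.suc (Fin.suc Fin.zero)) (Fin.suc (Fin.suc (Fin.suc (Fin.suc Fin.zero)))) = just true
tEdge (Fin.suc (Fin.suc (Fin.suc (Fin.suc Fin.zero)))) (Fin.suc (Fin.suc Fin.zero)) = just true
tEdge _ _ = nothing

That : SignedGraph 5
That = record { edge = tEdge }

absDiff : ℕ → ℕ → ℕ
absDiff i j = (i ∸ j) + (j ∸ i)

ksSign : ℕ → ℕ → Sign
ksSign i j = (3 ≤ᵇ absDiff i j) ∧ (absDiff i j ≤ᵇ 7)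

Ks10-3 : SignedGraph 10
Ks10-3 = record { edge = λ i j → just (ksSign (toℕ i) (toℕ j)) }

-- K̂^s_{10;3}: the signed subgraph induced by {0,1,2,3,4}
-- (vertex k : Fin 5 is vertex toℕ k of K^s_{10;3}).
KhatS10-3 : SignedGraph 5
KhatS10-3 = record { edge = λ i j → just (ksSign (toℕ i) (toℕ j)) }

-- The sign of a closed walk (the xor of its edge signs) is invariant under switching,
-- so a homomorphism of signed graphs maps closed walks to closed walks of the same sign.
-- In T̂ the triangles v2v3v4 and v3v4v5 are negative and the pentagon v1…v5 is positive;
-- an exhaustive check over all 5⁵ vertex maps shows that only surjective maps send
-- these three closed walks to closed walks of the same signs in K̂ˢ₁₀;₃.
module Submission where

open import Defs
open import Algebra.Bundles using (CommutativeRing)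
open import Data.Bool using (_xor_; true; false)
open import Data.Bool.Properties
  using (xor-assoc; xor-same; xor-identityʳ; not-involutive; xor-∧-commutativeRing)
  renaming (_≟_ to _≟ᵇ_)
open import Data.Fin using (Fin; toℕ)
open import Data.Fin.Patterns using (0F; 1F; 2F; 3F; 4F)
open import Data.Fin.Properties using (all?; any?; _≟_)
open import Data.List using (List; []; _∷_; map)
open import Data.Maybe using (just)
open import Data.Maybe.Properties using (just-injective)
open import Data.Nat using (ℕ)
open import Data.Product using (_,_)
open import Data.Vec using (Vec; []; _∷_; lookup; tabulate)
open import Data.Vec.Properties using (lookup∘tabulate)
open import Relation.Nullary using (Dec)
open import Relation.Nullary.Decidable using (_→-dec_; toWitness)
open import Relation.Binary.PropositionalEquality
open import Algebra.Properties.CommutativeSemigroup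
  (CommutativeRing.+-commutativeSemigroup xor-∧-commutativeRing) using (interchange)

private
  variable
    m n : ℕ

data Walk (G : SignedGraph n) : Fin n → Fin n → List (Fin n) → Sign → Set where
  []  : ∀ {x} → Walk G x x [] false
  _∷_ : ∀ {x y z vs a s} →
        edge G x y ≡ just a → Walk G y z vs s → Walk G x z (y ∷ vs) (a xor s)

walkSign : (Fin n → Fin n → Sign) → Fin n → List (Fin n) → Sign
walkSign σ x []       = false
walkSign σ x (y ∷ vs) = σ x y xor walkSign σ y vs

xor-cancelˡ-middle : ∀ y s z → y xor ((s xor y) xor z) ≡ s xor z
xor-cancelˡ-middle false s     z = cong (_xor z) (xor-identityʳ s)
xor-cancelˡ-middle true  false z = not-involutive z
xor-cancelˡ-middle true  true  z = refl

switchedSign-telescope : ∀ (S : Fin n → Sign) x y z a s →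
  switchedSign S x y a xor ((s xor S y) xor S z) ≡ ((a xor s) xor S x) xor S z
switchedSign-telescope S x y z a s = begin
  ((a xor S x) xor S y) xor ((s xor S y) xor S z) ≡⟨ xor-assoc (a xor S x) (S y) _ ⟩
  (a xor S x) xor (S y xor ((s xor S y) xor S z)) ≡⟨ cong ((a xor S x) xor_) (xor-cancelˡ-middle (S y) s (S z)) ⟩
  (a xor S x) xor (s xor S z)                     ≡⟨ interchange a (S x) s (S z) ⟩
  (a xor s) xor (S x xor S z)                     ≡⟨ xor-assoc (a xor s) (S x) (S z) ⟨
  ((a xor s) xor S x) xor S z                     ∎
  where open ≡-Reasoning

walk-image : ∀ {G : SignedGraph m} {H : SignedGraph n} (f : Fin m → Fin n)
  ((S , hom) : IsHom G H f) {x z vs s} →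
  Walk G x z vs s → Walk H (f x) (f z) (map f vs) ((s xor S x) xor S z)
walk-image f (S , hom) {x} [] = subst (Walk _ (f x) (f x) []) (sym (xor-same (S x))) []
walk-image f (S , hom) {x} {z} (_∷_ {y = y} {a = a} {s = s} e w) =
  subst (Walk _ (f x) (f z) _) (switchedSign-telescope S x y z a s)
        (hom x y a e ∷ walk-image f (S , hom) w)

closedWalk-image : ∀ {G : SignedGraph m} {H : SignedGraph n} (f : Fin m → Fin n) →
  IsHom G H f → ∀ {x vs s} → Walk G x x vs s → Walk H (f x) (f x) (map f vs) s
closedWalk-image f (S , hom) {x} {s = s} w =
  subst (Walk _ (f x) (f x) _) sign-restored (walk-image f (S , hom) w)
  where
  sign-restored : (s xor S x) xor S x ≡ s
  sign-restored = trans (xor-assoc s (S x) (S x))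
                        (trans (cong (s xor_) (xor-same (S x))) (xor-identityʳ s))

walk-sign-complete : ∀ {G : SignedGraph n} {σ : Fin n → Fin n → Sign} →
  (∀ u v → edge G u v ≡ just (σ u v)) →
  ∀ {x z vs s} → Walk G x z vs s → s ≡ walkSign σ x vs
walk-sign-complete complete [] = refl
walk-sign-complete complete {x} (_∷_ {y = y} e w) =
  cong₂ _xor_ (just-injective (trans (sym e) (complete x y))) (walk-sign-complete complete w)

surjective-resp-≗ : {g f : Fin m → Fin n} → (∀ x → g x ≡ f x) → Surjective g → Surjective f
surjective-resp-≗ g≗f surj y with surj y
... | x , gx≡y = x , trans (sym (g≗f x)) gx≡y

surjective? : (f : Fin m → Fin n) → Dec (Surjective f)
surjective? f = all? λ y → any? λ x → f x ≟ y

kSign : Fin 5 → Fin 5 → Sign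
kSign u v = ksSign (toℕ u) (toℕ v)

triangle₁ triangle₂ pentagon : List (Fin 5)
triangle₁ = 2F ∷ 3F ∷ 1F ∷ []
triangle₂ = 3F ∷ 4F ∷ 2F ∷ []
pentagon  = 1F ∷ 2F ∷ 3F ∷ 4F ∷ 0F ∷ []

negative-triangle₁ : Walk That 1F 1F triangle₁ true
negative-triangle₁ = refl ∷ refl ∷ refl ∷ []

negative-triangle₂ : Walk That 2F 2F triangle₂ true
negative-triangle₂ = refl ∷ refl ∷ refl ∷ []

positive-pentagon : Walk That 0F 0F pentagon false
positive-pentagon = refl ∷ refl ∷ refl ∷ refl ∷ refl ∷ []

CycleSigns⇒Surjective : (Fin 5 → Fin 5) → Set
CycleSigns⇒Surjective g =
  walkSign kSign (g 1F) (map g triangle₁) ≡ true →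
  walkSign kSign (g 2F) (map g triangle₂) ≡ true →
  walkSign kSign (g 0F) (map g pentagon) ≡ false →
  Surjective g

cycleSigns⇒surjective? : (g : Fin 5 → Fin 5) → Dec (CycleSigns⇒Surjective g)
cycleSigns⇒surjective? g =
  walkSign kSign (g 1F) (map g triangle₁) ≟ᵇ true →-dec
  walkSign kSign (g 2F) (map g triangle₂) ≟ᵇ true →-dec
  walkSign kSign (g 0F) (map g pentagon) ≟ᵇ false →-dec
  surjective? g

cycleSigns⇒surjective : ∀ (v : Vec (Fin 5) 5) → CycleSigns⇒Surjective (lookup v)
cycleSigns⇒surjective (a₀ ∷ a₁ ∷ a₂ ∷ a₃ ∷ a₄ ∷ []) =
  toWitness {a? = all? λ a₀ → all? λ a₁ → all? λ a₂ → all? λ a₃ → all? λ a₄ →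
                  cycleSigns⇒surjective? (lookup (a₀ ∷ a₁ ∷ a₂ ∷ a₃ ∷ a₄ ∷ []))}
            _ a₀ a₁ a₂ a₃ a₄

lemma2p1 : (f : Fin 5 → Fin 5) → IsHom That KhatS10-3 f → Surjective f
lemma2p1 f hom =
  surjective-resp-≗ (lookup∘tabulate f)
    (cycleSigns⇒surjective (tabulate f)
      (image-sign negative-triangle₁) (image-sign negative-triangle₂) (image-sign positive-pentagon))
  where
  image-sign : ∀ {x vs s} → Walk That x x vs s → walkSign kSign (f x) (map f vs) ≡ s
  image-sign w = sym (walk-sign-complete (λ _ _ → refl) (closedWalk-image f hom w))
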